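{- Let $T$ be a tableau with $k$ columns, let $b_i$ be the bottom entry of its $i$th column, and let $e=(e_1,\dots,e_m)$ be the earliest weakly increasing subsequence of $(b_1,\dots,b_k)$. Then the bottom entry $R_{1B}(T)$ of the first column $R_1(T)$ of the right key of $T$ equals $e_m$ (i.e., $R_{1B}(T)=S_{1B}(T)$).
   Context: Conventions: English notation. A shape is a weakly decreasing sequence $\zeta=(\zeta_1\ge\dots\ge\zeta_k)$ of positive integers (column lengths); a tableau of shape $\zeta$ fills the Young diagram with positive integers strictly increasing down columns and weakly increasing along rows. EWIS: for a sequence $(x_1,x_2,\dots)$, its earliest weakly increasing subsequence is $(x_{i_1},x_{i_2},\dots)$ with $i_1=1$ and, for $j>1$, $i_j$ the smallest index $>i_{j-1}$ with $x_{i_j}\ge x_{i_{j-1}}$. $S_{1B}(T)$ denotes the last member $e_m$ of the EWIS of the sequence of bottom entries of the columns of $T$. Right key: skew diagrams $\zeta\setminus\eta$, skew tableaux (fillings strictly increasing down columns, weakly increasing along rows), JDT/RJDT slides and rectification are standard (Fulton, "Young Tableaux"). A skew tableau is frank if its column lengths are a rearrangement of those of its rectification; the rightmost column of a frank skew tableau rectifying to $T$ is known to depend only on its length. $R_1(T)$ is the rightmost column of any frank skew tableau whose rightmost column has length $\zeta_1$ and which rectifies to $T$; $R_{1B}(T)$ is its bottom entry. -}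

module Defs where

open import Data.Nat using (ℕ; zero; suc; _+_; _∸_; _≤_; _<_; _≤?_; _<?_; _≟_; _≤ᵇ_)
open import Data.Bool using (if_then_else_)
open import Data.Maybe using (Maybe; just; nothing)
open import Data.List using (List; []; _∷_; _∷ʳ_; length; map; filter)
open import Data.List.Relation.Unary.All using (All)
open import Data.List.Relation.Unary.Linked using (Linked)
open import Data.List.Relation.Binary.Permutation.Propositional using (_↭_)
open import Data.Product using (Σ; _×_; _,_; proj₂)
open import Data.Product.Properties using (≡-dec)
open import Data.Sum using (_⊎_)
open import Relation.Nullary using (yes; no)
open import Relation.Binary.PropositionalEquality using (_≡_)
open import Relation.Binary.Construct.Closure.ReflexiveTransitive using (Star)

-- English notation.  A (straight) tableau is a list of columns, left to
-- right; each column is the list of its entries, top to bottom.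
Column : Set
Column = List ℕ

-- A skew column: (η_j , entries), where η_j is the number of cells of the
-- inner shape η in this column; the entries occupy rows η_j, …, ζ_j - 1
-- (rows counted from 0).  A skew tableau is the list of its skew columns,
-- left to right (empty columns are allowed).
SkewColumn : Set
SkewColumn = ℕ × List ℕ

SkewTab : Set
SkewTab = List SkewColumn

nth : List ℕ → ℕ → Maybe ℕ
nth []       _       = nothing
nth (x ∷ xs) zero    = just x
nth (x ∷ xs) (suc i) = nth xs i

entry : SkewTab → ℕ → ℕ → Maybe ℕ
entry []             j       r = nothing
entry ((o , c) ∷ S)  zero    r = if o ≤ᵇ r then nth c (r ∸ o) else nothing
entry (_ ∷ S)        (suc j) r = entry S j r

offsetAt : SkewTab → ℕ → ℕ
offsetAt []            j       = 0
offsetAt ((o , _) ∷ S) zero    = o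
offsetAt (_ ∷ S)       (suc j) = offsetAt S j

-- consecutive columns: η and ζ both weakly decreasing
ShapeStep : SkewColumn → SkewColumn → Set
ShapeStep (o , c) (o' , c') = (o' ≤ o) × (o' + length c' ≤ o + length c)

IsSkewTableau : SkewTab → Set
IsSkewTableau S =
  Linked ShapeStep S
  × All (λ col → All (λ x → 0 < x) (proj₂ col)) S
  × All (λ col → Linked _<_ (proj₂ col)) S
  × (∀ j r x y → entry S j r ≡ just x → entry S (suc j) r ≡ just y → x ≤ y)

toSkew : List Column → SkewTab
toSkew T = map (λ c → (0 , c)) T

IsTableau : List Column → Set
IsTableau T = IsSkewTableau (toSkew T) × All (λ c → 0 < length c) T

Cell : Set
Cell = ℕ × ℕ   -- (column , row)

InnerCorner : SkewTab → ℕ → ℕ → Set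
InnerCorner S j r = (suc r ≡ offsetAt S j) × (offsetAt S (suc j) ≤ r)

-- HolePath S h cs : starting with an empty box at h, the successive cells
-- the empty box moves to (the smaller of the neighbours below / to the right
-- slides into it; if they are equal, the one below).
data HolePath (S : SkewTab) : Cell → List Cell → Set where
  stop  : ∀ {j r} → entry S j (suc r) ≡ nothing → entry S (suc j) r ≡ nothing →
          HolePath S (j , r) []
  down  : ∀ {j r x cs} → entry S j (suc r) ≡ just x →
          (entry S (suc j) r ≡ nothing ⊎ Σ ℕ (λ y → (entry S (suc j) r ≡ just y) × (x ≤ y))) →
          HolePath S (j , suc r) cs → HolePath S (j , r) ((j , suc r) ∷ cs)
  right : ∀ {j r y cs} → entry S (suc j) r ≡ just y →
          (entry S j (suc r) ≡ nothing ⊎ Σ ℕ (λ x → (entry S j (suc r) ≡ just x) × (y < x))) →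
          HolePath S (suc j , r) cs → HolePath S (j , r) ((suc j , r) ∷ cs)

_≟c_ : (a b : Cell) → Relation.Nullary.Dec (a ≡ b)
_≟c_ = ≡-dec _≟_ _≟_

slideEntry : SkewTab → Cell → List Cell → Cell → Maybe ℕ
slideEntry S h [] d with d ≟c h
... | yes _ = nothing
... | no  _ = entry S (Data.Product.proj₁ d) (proj₂ d)
slideEntry S h (h' ∷ cs) d with d ≟c h
... | yes _ = entry S (Data.Product.proj₁ h') (proj₂ h')
... | no  _ = slideEntry S h' cs d

Slide : SkewTab → SkewTab → Set
Slide S S' =
  Σ ℕ λ j → Σ ℕ λ r → Σ (List Cell) λ cs →
    InnerCorner S j r × HolePath S (j , r) cs × IsSkewTableau S'
    × (∀ j' r' → entry S' j' r' ≡ slideEntry S (j , r) cs (j' , r'))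

Rectifies : SkewTab → List Column → Set
Rectifies S T = Σ SkewTab λ S' → Star Slide S S' × (∀ j r → entry S' j r ≡ entry (toSkew T) j r)

Frank : SkewTab → List Column → Set
Frank S T = filter (λ n → 0 <? n) (map (λ col → length (proj₂ col)) S) ↭ map length T

ζ₁ : List Column → ℕ
ζ₁ []      = 0
ζ₁ (c ∷ _) = length c

IsR1 : List Column → Column → Set
IsR1 T c = Σ SkewTab λ S₀ → Σ ℕ λ o →
  IsSkewTableau (S₀ ∷ʳ (o , c)) × Rectifies (S₀ ∷ʳ (o , c)) T
  × Frank (S₀ ∷ʳ (o , c)) T × (length c ≡ ζ₁ T)

-- last element (bottom entry of a column; last member of a sequence); 0 on []
bottom : List ℕ → ℕ
bottom []           = 0
bottom (x ∷ [])     = x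
bottom (x ∷ y ∷ ys) = bottom (y ∷ ys)

ewisFrom : ℕ → List ℕ → List ℕ
ewisFrom x []       = []
ewisFrom x (y ∷ ys) with x ≤? y
... | yes _ = y ∷ ewisFrom y ys
... | no  _ = ewisFrom x ys

ewis : List ℕ → List ℕ
ewis []       = []
ewis (x ∷ xs) = x ∷ ewisFrom x xs

S1B : List Column → ℕ
S1B T = bottom (ewis (map bottom T))

-- S1B T, the last member of the EWIS of the column bottoms of T, is their maximum and hence the
-- largest entry of T.  Slides move entries without changing them, so bottom c, which then occurs
-- in T, is at most S1B T.  Conversely S1B T occurs in S, weakly left of the rightmost column c.
-- Weakly above the bottom of c it is at most bottom c since rows and columns of S increase; lower
-- down, a larger entry would extend c to a chain of ζ₁ + 1 entries strictly increasing both in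
-- value and in row.  A slide never shortens such a chain, whereas a chain in a tableau of height
-- ζ₁ has at most ζ₁ entries.

module Submission where

open import Defs
open import Data.Bool using (true; T; if_then_else_)
open import Data.Unit using (tt)
open import Data.Empty using (⊥-elim)
open import Data.Maybe using (Maybe; just; nothing)
open import Data.Maybe.Properties using (just-injective)
open import Data.Nat
open import Data.Nat.Properties
open import Data.List using (List; []; _∷_; _∷ʳ_; length; map)
open import Data.List.Relation.Unary.All as All using (All; []; _∷_)
open import Data.List.Relation.Unary.All.Properties using (map⁻)
open import Data.List.Relation.Unary.Any using (here; there)
open import Data.List.Membership.Propositional using (_∈_)
open import Data.List.Membership.Propositional.Properties using (∈-map⁺; ∈-map⁻)
open import Data.List.Relation.Unary.Linked using (Linked; []; [-]; _∷_)
open import Data.Product using (∃; ∃₂; _×_; _,_; proj₁; proj₂)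
open import Data.Sum using (_⊎_; inj₁; inj₂)
open import Relation.Binary.PropositionalEquality
open import Relation.Binary.Construct.Closure.ReflexiveTransitive using (Star; ε; _◅_)
open import Relation.Nullary using (yes; no)
open import Relation.Binary.Definitions using (tri<; tri≈; tri>)

columnAt : SkewTab → ℕ → SkewColumn
columnAt []      _       = (0 , [])
columnAt (x ∷ _) zero    = x
columnAt (_ ∷ S) (suc j) = columnAt S j

columnEntry : SkewColumn → ℕ → Maybe ℕ
columnEntry (o , c) r = if o ≤ᵇ r then nth c (r ∸ o) else nothing

inner outer : SkewTab → ℕ → ℕ
inner S j = proj₁ (columnAt S j)
outer S j = inner S j + length (proj₂ (columnAt S j))

entry≡columnEntry : ∀ S j r → entry S j r ≡ columnEntry (columnAt S j) r
entry≡columnEntry []            j       r = refl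
entry≡columnEntry ((o , c) ∷ S) zero    r = refl
entry≡columnEntry (_ ∷ S)       (suc j) r = entry≡columnEntry S j r

offsetAt≡inner : ∀ S j → offsetAt S j ≡ inner S j
offsetAt≡inner []            j       = refl
offsetAt≡inner ((o , c) ∷ S) zero    = refl
offsetAt≡inner (_ ∷ S)       (suc j) = offsetAt≡inner S j

columnAt-all : ∀ {P : SkewColumn → Set} {S} → P (0 , []) → All P S → ∀ j → P (columnAt S j)
columnAt-all p₀ []       j       = p₀
columnAt-all p₀ (p ∷ _)  zero    = p
columnAt-all p₀ (_ ∷ ps) (suc j) = columnAt-all p₀ ps j

nth-just⇒< : ∀ c i {x} → nth c i ≡ just x → i < length c
nth-just⇒< (_ ∷ c) zero    _ = s≤s z≤n
nth-just⇒< (_ ∷ c) (suc i) e = s≤s (nth-just⇒< c i e)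

<⇒nth-just : ∀ c i → i < length c → ∃ λ x → nth c i ≡ just x
<⇒nth-just (y ∷ c) zero    _       = y , refl
<⇒nth-just (_ ∷ c) (suc i) (s≤s p) = <⇒nth-just c i p

columnEntry-shifted : ∀ o c r → o ≤ r → columnEntry (o , c) r ≡ nth c (r ∸ o)
columnEntry-shifted o c r o≤r with o ≤ᵇ r | ≤⇒≤ᵇ o≤r
... | true | _ = refl

columnEntry-just⇒inShape : ∀ o c r {x} → columnEntry (o , c) r ≡ just x → o ≤ r × r < o + length c
columnEntry-just⇒inShape o c r e with o ≤ᵇ r in eq
... | true = o≤r , subst (_< o + length c) (m+[n∸m]≡n o≤r) (+-monoʳ-< o (nth-just⇒< c (r ∸ o) e))
  where o≤r = ≤ᵇ⇒≤ o r (subst T (sym eq) tt)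

entry⇒inShape : ∀ S j r {x} → entry S j r ≡ just x → inner S j ≤ r × r < outer S j
entry⇒inShape S j r e =
  columnEntry-just⇒inShape (inner S j) (proj₂ (columnAt S j)) r (trans (sym (entry≡columnEntry S j r)) e)

inShape⇒entry : ∀ S j r → inner S j ≤ r → r < outer S j → ∃ λ x → entry S j r ≡ just x
inShape⇒entry S j r o≤r r<outer = proj₁ found , entry≡
  where
  open ≡-Reasoning
  o = inner S j
  c = proj₂ (columnAt S j)
  found = <⇒nth-just c (r ∸ o) (subst (r ∸ o <_) (m+n∸m≡n o (length c)) (∸-monoˡ-< r<outer o≤r))
  entry≡ : entry S j r ≡ just (proj₁ found)
  entry≡ = begin
    entry S j r           ≡⟨ entry≡columnEntry S j r ⟩
    columnEntry (o , c) r ≡⟨ columnEntry-shifted o c r o≤r ⟩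
    nth c (r ∸ o)         ≡⟨ proj₂ found ⟩
    just (proj₁ found)    ∎

antitone-by-steps : (f : ℕ → ℕ) → (∀ j → f (suc j) ≤ f j) → ∀ {j k} → j ≤ k → f k ≤ f j
antitone-by-steps f step {j} j≤k = go (≤⇒≤′ j≤k)
  where
  go : ∀ {k} → j ≤′ k → f k ≤ f j
  go ≤′-refl       = ≤-refl
  go (≤′-step j≤k) = ≤-trans (step _) (go j≤k)

inner-step : ∀ {S} → Linked ShapeStep S → ∀ j → inner S (suc j) ≤ inner S j
inner-step []         j       = ≤-refl
inner-step [-]        zero    = z≤n
inner-step [-]        (suc j) = ≤-refl
inner-step (step ∷ _) zero    = proj₁ step
inner-step (_ ∷ L)    (suc j) = inner-step L j

outer-step : ∀ {S} → Linked ShapeStep S → ∀ j → outer S (suc j) ≤ outer S j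
outer-step []         j       = ≤-refl
outer-step [-]        zero    = z≤n
outer-step [-]        (suc j) = ≤-refl
outer-step (step ∷ _) zero    = proj₂ step
outer-step (_ ∷ L)    (suc j) = outer-step L j

inner-antitone : ∀ {S} → Linked ShapeStep S → ∀ {j k} → j ≤ k → inner S k ≤ inner S j
inner-antitone {S} L = antitone-by-steps (inner S) (inner-step L)

outer-antitone : ∀ {S} → Linked ShapeStep S → ∀ {j k} → j ≤ k → outer S k ≤ outer S j
outer-antitone {S} L = antitone-by-steps (outer S) (outer-step L)

nth-strict : ∀ {c} → Linked _<_ c → ∀ {i i' x y} → i < i' → nth c i ≡ just x → nth c i' ≡ just y → x < y
nth-strict [-]     {zero}  {suc _}       _        _    ()
nth-strict (p ∷ L) {zero}  {suc zero}    _        refl e' = subst (_ <_) (just-injective e') p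
nth-strict (p ∷ L) {zero}  {suc (suc i)} _        refl e' = <-trans p (nth-strict L (s≤s z≤n) refl e')
nth-strict (p ∷ L) {suc i} {suc i'}      (s≤s lt) e    e' = nth-strict L lt e e'

column-strict : ∀ {S} → IsSkewTableau S → ∀ {j r r' x y} →
                entry S j r ≡ just x → entry S j r' ≡ just y → r < r' → x < y
column-strict {S} (_ , _ , strict , _) {j} {r} {r'} e e' r<r' =
  nth-strict linked (∸-monoˡ-< r<r' o≤r) (onColumn r o≤r e) (onColumn r' o≤r' e')
  where
  o = inner S j
  c = proj₂ (columnAt S j)
  linked : Linked _<_ c
  linked = columnAt-all {P = λ col → Linked _<_ (proj₂ col)} [] strict j
  o≤r = proj₁ (entry⇒inShape S j r e)
  o≤r' = proj₁ (entry⇒inShape S j r' e')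
  onColumn : ∀ s {z} → o ≤ s → entry S j s ≡ just z → nth c (s ∸ o) ≡ just z
  onColumn s o≤s e = trans (sym (columnEntry-shifted o c s o≤s)) (trans (sym (entry≡columnEntry S j s)) e)

column-weak : ∀ {S} → IsSkewTableau S → ∀ {j r r' x y} →
              entry S j r ≡ just x → entry S j r' ≡ just y → r ≤ r' → x ≤ y
column-weak tab e e' r≤r' with m≤n⇒m<n∨m≡n r≤r'
... | inj₁ r<r' = <⇒≤ (column-strict tab e e' r<r')
... | inj₂ refl = ≤-reflexive (just-injective (trans (sym e) e'))

row-weak : ∀ {S} → IsSkewTableau S → ∀ {j k r x y} →
           entry S j r ≡ just x → entry S k r ≡ just y → j ≤ k → x ≤ y
row-weak {S} (shape , _ , _ , rows) {j} {k} {r} {x} e e' j≤k = go (≤⇒≤′ j≤k) e'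
  where
  go : ∀ {k y} → j ≤′ k → entry S k r ≡ just y → x ≤ y
  go ≤′-refl           e' = ≤-reflexive (just-injective (trans (sym e) e'))
  go (≤′-step {k} j≤k) e' with inShape⇒entry S k r
                                 (≤-trans (inner-antitone shape (≤′⇒≤ j≤k)) (proj₁ (entry⇒inShape S j r e)))
                                 (<-≤-trans (proj₂ (entry⇒inShape S (suc k) r e')) (outer-step shape k))
  ... | z , e'' = ≤-trans (go j≤k e'') (rows k r z _ e'' e')

entry-monotone : ∀ {S} → IsSkewTableau S → ∀ {j k r s x y} →
                 entry S j r ≡ just x → entry S k s ≡ just y → j ≤ k → r ≤ s → x ≤ y
entry-monotone {S} tab {j} {k} {r} {s} e e' j≤k r≤s =
  ≤-trans (column-weak tab e (proj₂ at-j) (m≤m⊔n r (inner S k)))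
    (≤-trans (row-weak tab (proj₂ at-j) (proj₂ at-k) j≤k) (column-weak tab (proj₂ at-k) e' r'≤s))
  where
  r' = r ⊔ inner S k
  r'≤s = ⊔-lub r≤s (proj₁ (entry⇒inShape S k s e'))
  r'<outer = ≤-<-trans r'≤s (proj₂ (entry⇒inShape S k s e'))
  at-j = inShape⇒entry S j r' (≤-trans (proj₁ (entry⇒inShape S j r e)) (m≤m⊔n r (inner S k)))
           (<-≤-trans r'<outer (outer-antitone (proj₁ tab) j≤k))
  at-k = inShape⇒entry S k r' (m≤n⊔m r (inner S k)) r'<outer

-- Jeu de taquin

Occurs : SkewTab → ℕ → Set
Occurs S x = ∃₂ λ j r → entry S j r ≡ just x

slideEntry-[] : ∀ S h d → d ≢ h → slideEntry S h [] d ≡ entry S (proj₁ d) (proj₂ d)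
slideEntry-[] S h d d≢h with d ≟c h
... | yes d≡h = ⊥-elim (d≢h d≡h)
... | no  _   = refl

slideEntry-hole : ∀ S h h' cs → slideEntry S h (h' ∷ cs) h ≡ entry S (proj₁ h') (proj₂ h')
slideEntry-hole S h h' cs with h ≟c h
... | yes _   = refl
... | no  h≢h = ⊥-elim (h≢h refl)

slideEntry-∷ : ∀ S h h' cs d → d ≢ h → slideEntry S h (h' ∷ cs) d ≡ slideEntry S h' cs d
slideEntry-∷ S h h' cs d d≢h with d ≟c h
... | yes d≡h = ⊥-elim (d≢h d≡h)
... | no  _   = refl

≢-column : ∀ {a b j r : ℕ} → a ≢ j → (a , b) ≢ (j , r)
≢-column a≢j refl = a≢j refl

≢-row : ∀ {a b j r : ℕ} → b ≢ r → (a , b) ≢ (j , r)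
≢-row b≢r refl = b≢r refl

slideEntry-outside : ∀ {S j r cs} → HolePath S (j , r) cs → ∀ {a b} → a < j ⊎ b < r →
                     slideEntry S (j , r) cs (a , b) ≡ entry S a b
slideEntry-outside {S} {j} {r} (stop _ _) {a} {b} outside = slideEntry-[] S (j , r) (a , b) (≢-hole outside)
  where
  ≢-hole : a < j ⊎ b < r → (a , b) ≢ (j , r)
  ≢-hole (inj₁ a<j) = ≢-column (<⇒≢ a<j)
  ≢-hole (inj₂ b<r) = ≢-row (<⇒≢ b<r)
slideEntry-outside {S} {j} {r} {_ ∷ cs} (down _ _ path) {a} {b} (inj₁ a<j) =
  trans (slideEntry-∷ S (j , r) _ cs (a , b) (≢-column (<⇒≢ a<j))) (slideEntry-outside path (inj₁ a<j))
slideEntry-outside {S} {j} {r} {_ ∷ cs} (down _ _ path) {a} {b} (inj₂ b<r) =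
  trans (slideEntry-∷ S (j , r) _ cs (a , b) (≢-row (<⇒≢ b<r))) (slideEntry-outside path (inj₂ (m<n⇒m<1+n b<r)))
slideEntry-outside {S} {j} {r} {_ ∷ cs} (right _ _ path) {a} {b} (inj₁ a<j) =
  trans (slideEntry-∷ S (j , r) _ cs (a , b) (≢-column (<⇒≢ a<j))) (slideEntry-outside path (inj₁ (m<n⇒m<1+n a<j)))
slideEntry-outside {S} {j} {r} {_ ∷ cs} (right _ _ path) {a} {b} (inj₂ b<r) =
  trans (slideEntry-∷ S (j , r) _ cs (a , b) (≢-row (<⇒≢ b<r))) (slideEntry-outside path (inj₂ b<r))

slideEntry-origin : ∀ S h cs d {x} → slideEntry S h cs d ≡ just x → Occurs S x
slideEntry-origin S h []        d e with d ≟c h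
... | no _ = proj₁ d , proj₂ d , e
slideEntry-origin S h (h' ∷ cs) d e with d ≟c h
... | yes _ = proj₁ h' , proj₂ h' , e
... | no  _ = slideEntry-origin S h' cs d e

slideEntry-filled⇒hole : ∀ {S h cs} → HolePath S h cs → ∀ d {x} →
                         slideEntry S h cs d ≡ just x → entry S (proj₁ d) (proj₂ d) ≡ nothing → d ≡ h
slideEntry-filled⇒hole {S} {h} (stop _ _) d e empty with d ≟c h
... | yes d≡h = d≡h
... | no  _ with () ← trans (sym e) empty
slideEntry-filled⇒hole {S} {h} (down below _ path) d e empty with d ≟c h
... | yes d≡h = d≡h
... | no  _ with refl ← slideEntry-filled⇒hole path d e empty with () ← trans (sym below) empty
slideEntry-filled⇒hole {S} {h} (right beside _ path) d e empty with d ≟c h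
... | yes d≡h = d≡h
... | no  _ with refl ← slideEntry-filled⇒hole path d e empty with () ← trans (sym beside) empty

data SlideMove (S : SkewTab) (h : Cell) (cs : List Cell) : ℕ → ℕ → ℕ → Set where
  stays     : ∀ {j r x} → slideEntry S h cs (j , r) ≡ just x → SlideMove S h cs j r x
  movesLeft : ∀ {j r x} → proj₁ h ≤ j → proj₂ h ≤ r → slideEntry S h cs (j , r) ≡ just x →
              SlideMove S h cs (suc j) r x
  movesUp   : ∀ {j r x} → proj₁ h ≤ j → proj₂ h ≤ r → slideEntry S h cs (j , r) ≡ just x →
              (∀ {a} → a < j → slideEntry S h cs (a , suc r) ≡ entry S a (suc r)) →
              SlideMove S h cs j (suc r) x

slide-move : ∀ {S h cs} → HolePath S h cs → ∀ {j r x} → entry S j r ≡ just x → (j , r) ≢ h →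
             SlideMove S h cs j r x
slide-move {S} {h} (stop _ _) {j} {r} e ≢h = stays (trans (slideEntry-[] S h (j , r) ≢h) e)
slide-move {S} {j₀ , r₀} {_ ∷ cs} (down _ _ path) {j} {r} e ≢h with (j , r) ≟c (j₀ , suc r₀)
... | yes refl = movesUp ≤-refl ≤-refl (trans (slideEntry-hole S (j₀ , r₀) _ cs) e)
                   (λ a<j → trans (slideEntry-∷ S _ _ cs _ (≢-row (>⇒≢ (n<1+n r₀)))) (slideEntry-outside path (inj₁ a<j)))
... | no ≢next with slide-move path e ≢next
...   | stays p = stays (trans (slideEntry-∷ S _ _ cs _ ≢h) p)
...   | movesLeft j₀≤ r₀< p = movesLeft j₀≤ (<⇒≤ r₀<) (trans (slideEntry-∷ S _ _ cs _ (≢-row (>⇒≢ r₀<))) p)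
...   | movesUp j₀≤ r₀< p left =
        movesUp j₀≤ (<⇒≤ r₀<) (trans (slideEntry-∷ S _ _ cs _ (≢-row (>⇒≢ r₀<))) p)
          (λ a<j → trans (slideEntry-∷ S _ _ cs _ (≢-row (>⇒≢ (m<n⇒m<1+n r₀<)))) (left a<j))
slide-move {S} {j₀ , r₀} {_ ∷ cs} (right _ _ path) {j} {r} e ≢h with (j , r) ≟c (suc j₀ , r₀)
... | yes refl = movesLeft ≤-refl ≤-refl (trans (slideEntry-hole S (j₀ , r₀) _ cs) e)
... | no ≢next with slide-move path e ≢next
...   | stays p = stays (trans (slideEntry-∷ S _ _ cs _ ≢h) p)
...   | movesLeft j₀< r₀≤ p = movesLeft (<⇒≤ j₀<) r₀≤ (trans (slideEntry-∷ S _ _ cs _ (≢-column (>⇒≢ j₀<))) p)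
...   | movesUp j₀< r₀≤ p left =
        movesUp (<⇒≤ j₀<) r₀≤ (trans (slideEntry-∷ S _ _ cs _ (≢-column (>⇒≢ j₀<))) p)
          (λ a<j → trans (slideEntry-∷ S _ _ cs _ (≢-row (>⇒≢ (s≤s r₀≤)))) (left a<j))

-- Chains

data Chain (S : SkewTab) : ℕ → ℕ → ℕ → ℕ → Set where
  one  : ∀ {j r x} → entry S j r ≡ just x → Chain S 1 j r x
  snoc : ∀ {n j r x k s y} → Chain S n j r x → entry S k s ≡ just y → r < s → x < y → Chain S (suc n) k s y

chain-end : ∀ {S n j r x} → Chain S n j r x → entry S j r ≡ just x
chain-end (one e)        = e
chain-end (snoc _ e _ _) = e

chain-length≤ : ∀ {S n j r x} → Chain S n j r x → n ≤ suc r
chain-length≤ (one _)           = s≤s z≤n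
chain-length≤ (snoc ch _ r<s _) = s≤s (≤-trans (chain-length≤ ch) r<s)

chain-cong : ∀ {S S'} → (∀ j r → entry S j r ≡ entry S' j r) → ∀ {n j r x} → Chain S n j r x → Chain S' n j r x
chain-cong S≗S' (one e)             = one (trans (sym (S≗S' _ _)) e)
chain-cong S≗S' (snoc ch e r<s x<y) = snoc (chain-cong S≗S' ch) (trans (sym (S≗S' _ _)) e) r<s x<y

column-chain : ∀ {S} → IsSkewTableau S → ∀ {j r x} → entry S j r ≡ just x → Chain S (suc (r ∸ inner S j)) j r x
column-chain {S} tab {j} {zero} {x} e = subst (λ n → Chain S (suc n) j 0 x) (sym (0∸n≡0 (inner S j))) (one e)
column-chain {S} tab {j} {suc r} {x} e with inner S j ≤? r
... | yes inner≤r with inShape⇒entry S j r inner≤r (<-trans (n<1+n r) (proj₂ (entry⇒inShape S j (suc r) e)))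
...   | _ , e' = subst (λ n → Chain S (suc n) j (suc r) x) (sym (+-∸-assoc 1 inner≤r))
                   (snoc (column-chain tab e') e (n<1+n r) (column-strict tab e' e (n<1+n r)))
column-chain {S} tab {j} {suc r} {x} e | no inner≰r =
  subst (λ n → Chain S (suc n) j (suc r) x) (sym (trans (cong (suc r ∸_) inner≡) (n∸n≡0 (suc r)))) (one e)
  where
  inner≡ : inner S j ≡ suc r
  inner≡ = ≤-antisym (proj₁ (entry⇒inShape S j (suc r) e)) (≰⇒> inner≰r)

module OneSlide {S S' : SkewTab} (tab : IsSkewTableau S) (tab' : IsSkewTableau S')
  {j₀ r₀ : ℕ} {cs : List Cell} (corner : InnerCorner S j₀ r₀) (path : HolePath S (j₀ , r₀) cs)
  (S'≡ : ∀ j r → entry S' j r ≡ slideEntry S (j₀ , r₀) cs (j , r)) where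

  inner-hole : inner S j₀ ≡ suc r₀
  inner-hole = trans (sym (offsetAt≡inner S j₀)) (sym (proj₁ corner))

  entry≢hole : ∀ {j r x} → entry S j r ≡ just x → (j , r) ≢ (j₀ , r₀)
  entry≢hole {j} {r} e refl = 1+n≰n (subst (_≤ r₀) inner-hole (proj₁ (entry⇒inShape S j r e)))

  move : ∀ {j r x} → entry S j r ≡ just x → SlideMove S (j₀ , r₀) cs j r x
  move e = slide-move path e (entry≢hole e)

  keeps-occurrence : ∀ {j r x} → entry S j r ≡ just x → Occurs S' x
  keeps-occurrence e with move e
  ... | stays p         = _ , _ , trans (S'≡ _ _) p
  ... | movesLeft _ _ p = _ , _ , trans (S'≡ _ _) p
  ... | movesUp _ _ p _ = _ , _ , trans (S'≡ _ _) p

  -- For a chain whose last entry v slides up into the row of the previous end (a, r): the entry y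
  -- of S below that end is left in place by the slide and w < y ≤ v, so y can replace v.
  extend-below : ∀ {n a r w b v} → Chain S' n a r w → entry S' b r ≡ just v → w < v →
                 (∀ {a} → a < b → slideEntry S (j₀ , r₀) cs (a , suc r) ≡ entry S a (suc r)) →
                 entry S b (suc r) ≡ just v →
                 ∃ λ y → Chain S' (suc n) a (suc r) y × y ≤ v
  extend-below {n} {a} {r} {w} {b} {v} ch e'v w<v unchanged ev = y , snoc ch e'y (n<1+n r) w<y , y≤v
    where
    e'w = chain-end ch
    a<b : a < b
    a<b with <-cmp a b
    ... | tri< a<b _ _ = a<b
    ... | tri≈ _ refl _ = ⊥-elim (<-irrefl (just-injective (trans (sym e'w) e'v)) w<v)
    ... | tri> _ _ b<a = ⊥-elim (<⇒≱ w<v (row-weak tab' e'v e'w (<⇒≤ b<a)))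
    inner≤ : inner S a ≤ suc r
    inner≤ with entry S a r in ea
    ... | just _  = m≤n⇒m≤1+n (proj₁ (entry⇒inShape S a r ea))
    ... | nothing with refl ← slideEntry-filled⇒hole path (a , r) (trans (sym (S'≡ a r)) e'w) ea =
          ≤-reflexive inner-hole
    below = inShape⇒entry S a (suc r) inner≤
              (<-≤-trans (proj₂ (entry⇒inShape S b (suc r) ev)) (outer-antitone (proj₁ tab) (<⇒≤ a<b)))
    y = proj₁ below
    e'y : entry S' a (suc r) ≡ just y
    e'y = trans (S'≡ a (suc r)) (trans (unchanged a<b) (proj₂ below))
    w<y = column-strict tab' e'w e'y (n<1+n r)
    y≤v = row-weak tab (proj₂ below) ev (<⇒≤ a<b)

  preserves-chain : ∀ {n k s y} → Chain S n k s y →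
                    ∃₂ λ k' s' → ∃ λ y' → Chain S' n k' s' y' × y' ≤ y × s' ≤ s
  preserves-chain (one e) with move e
  ... | stays p                  = _ , _ , _ , one (trans (S'≡ _ _) p) , ≤-refl , ≤-refl
  ... | movesLeft _ _ p          = _ , _ , _ , one (trans (S'≡ _ _) p) , ≤-refl , ≤-refl
  ... | movesUp {r = s'} _ _ p _ = _ , _ , _ , one (trans (S'≡ _ _) p) , ≤-refl , n≤1+n s'
  preserves-chain (snoc ch e r<s x<y) with preserves-chain ch | move e
  ... | (_ , r' , _ , ch' , x'≤x , r'≤r) | stays p =
        _ , _ , _ , snoc ch' (trans (S'≡ _ _) p) (≤-<-trans r'≤r r<s) (≤-<-trans x'≤x x<y) , ≤-refl , ≤-refl
  ... | (_ , r' , _ , ch' , x'≤x , r'≤r) | movesLeft _ _ p =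
        _ , _ , _ , snoc ch' (trans (S'≡ _ _) p) (≤-<-trans r'≤r r<s) (≤-<-trans x'≤x x<y) , ≤-refl , ≤-refl
  ... | (_ , r' , _ , ch' , x'≤x , r'≤r) | movesUp {r = s'} _ _ p unchanged with r' <? s'
  ...   | yes r'<s' = _ , _ , _ , snoc ch' (trans (S'≡ _ _) p) r'<s' (≤-<-trans x'≤x x<y) , ≤-refl , n≤1+n s'
  ...   | no  r'≮s' with refl ← ≤-antisym (≤-pred (≤-<-trans r'≤r r<s)) (≮⇒≥ r'≮s')
          with extend-below ch' (trans (S'≡ _ _) p) (≤-<-trans x'≤x x<y) unchanged e
  ...     | _ , ch'' , y'≤y = _ , _ , _ , ch'' , y'≤y , ≤-refl

slides-keep-occurrence : ∀ {S S'} → IsSkewTableau S → Star Slide S S' →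
                         ∀ {j r x} → entry S j r ≡ just x → Occurs S' x
slides-keep-occurrence tab ε e = _ , _ , e
slides-keep-occurrence tab ((_ , _ , _ , corner , path , tab' , S'≡) ◅ slides) e
  with OneSlide.keeps-occurrence tab tab' corner path S'≡ e
... | _ , _ , e' = slides-keep-occurrence tab' slides e'

slides-preserve-chain : ∀ {S S'} → IsSkewTableau S → Star Slide S S' →
                        ∀ {n k s y} → Chain S n k s y → ∃₂ λ k' s' → ∃ λ y' → Chain S' n k' s' y'
slides-preserve-chain tab ε ch = _ , _ , _ , ch
slides-preserve-chain tab ((_ , _ , _ , corner , path , tab' , S'≡) ◅ slides) ch
  with OneSlide.preserves-chain tab tab' corner path S'≡ ch
... | _ , _ , _ , ch' , _ = slides-preserve-chain tab' slides ch'

slides-occurrence-origin : ∀ {S S'} → Star Slide S S' → ∀ {j r x} → entry S' j r ≡ just x → Occurs S x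
slides-occurrence-origin ε e = _ , _ , e
slides-occurrence-origin {S} ((j₀ , r₀ , cs , _ , _ , _ , S'≡) ◅ slides) e
  with slides-occurrence-origin slides e
... | j , r , e' = slideEntry-origin S (j₀ , r₀) cs (j , r) (trans (sym (S'≡ j r)) e')

rectification-keeps-occurrence : ∀ {S T} → IsSkewTableau S → Rectifies S T →
                                 ∀ {j r x} → entry S j r ≡ just x → Occurs (toSkew T) x
rectification-keeps-occurrence tab (_ , slides , S'≗T) e with slides-keep-occurrence tab slides e
... | j , r , e' = j , r , trans (sym (S'≗T j r)) e'

rectification-occurrence-origin : ∀ {S T} → Rectifies S T →
                                  ∀ {j r x} → entry (toSkew T) j r ≡ just x → Occurs S x
rectification-occurrence-origin (_ , slides , S'≗T) {j} {r} e = slides-occurrence-origin slides (trans (S'≗T j r) e)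

rectification-preserves-chain : ∀ {S T} → IsSkewTableau S → Rectifies S T →
                                ∀ {n k s y} → Chain S n k s y → ∃₂ λ k' s' → ∃ λ y' → Chain (toSkew T) n k' s' y'
rectification-preserves-chain tab (_ , slides , S'≗T) ch with slides-preserve-chain tab slides ch
... | k , s , y , ch' = k , s , y , chain-cong S'≗T ch'

-- Tableaux and the earliest weakly increasing subsequence

ewisFrom-last-≥ : ∀ x l → x ≤ bottom (x ∷ ewisFrom x l)
ewisFrom-last-≥ x []       = ≤-refl
ewisFrom-last-≥ x (y ∷ ys) with x ≤? y
... | yes x≤y = ≤-trans x≤y (ewisFrom-last-≥ y ys)
... | no  _   = ewisFrom-last-≥ x ys

ewisFrom-last-maximal : ∀ x l {z} → z ∈ l → z ≤ bottom (x ∷ ewisFrom x l)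
ewisFrom-last-maximal x (y ∷ ys) z∈ with x ≤? y | z∈
... | yes _   | here refl = ewisFrom-last-≥ y ys
... | yes _   | there z∈ys = ewisFrom-last-maximal y ys z∈ys
... | no  x≰y | here refl = ≤-trans (<⇒≤ (≰⇒> x≰y)) (ewisFrom-last-≥ x ys)
... | no  _   | there z∈ys = ewisFrom-last-maximal x ys z∈ys

ewisFrom-last-∈ : ∀ x l → bottom (x ∷ ewisFrom x l) ∈ x ∷ l
ewisFrom-last-∈ x []       = here refl
ewisFrom-last-∈ x (y ∷ ys) with x ≤? y
... | yes _ = there (ewisFrom-last-∈ y ys)
... | no  _ with ewisFrom-last-∈ x ys
...   | here  last≡x = here last≡x
...   | there last∈ys = there (there last∈ys)

ewis-last-maximal : ∀ xs {z} → z ∈ xs → z ≤ bottom (ewis xs)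
ewis-last-maximal (x ∷ xs) (here refl) = ewisFrom-last-≥ x xs
ewis-last-maximal (x ∷ xs) (there z∈xs) = ewisFrom-last-maximal x xs z∈xs

nth≤bottom : ∀ {c} → Linked _<_ c → ∀ r {x} → nth c r ≡ just x → x ≤ bottom c
nth≤bottom [-]         zero    refl = ≤-refl
nth≤bottom (x<y ∷ L)   zero    refl = ≤-trans (<⇒≤ x<y) (nth≤bottom L zero refl)
nth≤bottom (_ ∷ L)     (suc r) e    = nth≤bottom L r e

nth-bottom : ∀ c → 0 < length c → nth c (pred (length c)) ≡ just (bottom c)
nth-bottom (x ∷ [])     _ = refl
nth-bottom (x ∷ y ∷ ys) _ = nth-bottom (y ∷ ys) (s≤s z≤n)

tableau-entry : ∀ T {j r x} → entry (toSkew T) j r ≡ just x → ∃ λ c → c ∈ T × nth c r ≡ just x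
tableau-entry (c ∷ T) {zero}  e = c , here refl , e
tableau-entry (_ ∷ T) {suc j} e with tableau-entry T e
... | c , c∈T , e' = c , there c∈T , e'

tableau-bottom-occurs : ∀ {T c} → All (λ c → 0 < length c) T → c ∈ T → Occurs (toSkew T) (bottom c)
tableau-bottom-occurs {c = c} (nonempty ∷ _) (here refl) = 0 , pred (length c) , nth-bottom c nonempty
tableau-bottom-occurs         (_ ∷ nonempty) (there c∈T) with tableau-bottom-occurs nonempty c∈T
... | j , r , e = suc j , r , e

tableau-entry≤S1B : ∀ {T} → IsTableau T → ∀ {j r x} → entry (toSkew T) j r ≡ just x → x ≤ S1B T
tableau-entry≤S1B {T} ((_ , _ , strict , _) , _) {r = r} e with tableau-entry T e
... | c , c∈T , e' =
  ≤-trans (nth≤bottom (All.lookup (map⁻ strict) c∈T) r e') (ewis-last-maximal (map bottom T) (∈-map⁺ bottom c∈T))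

S1B-occurs : ∀ {T} → IsTableau T → 0 < length T → Occurs (toSkew T) (S1B T)
S1B-occurs {c ∷ T} (_ , nonempty) _ with ∈-map⁻ bottom (ewisFrom-last-∈ (bottom c) (map bottom T))
... | c' , c'∈T , S1B≡ = subst (Occurs (toSkew (c ∷ T))) (sym S1B≡) (tableau-bottom-occurs nonempty c'∈T)

tableau-row<ζ₁ : ∀ {T} → IsTableau T → ∀ {j r x} → entry (toSkew T) j r ≡ just x → r < ζ₁ T
tableau-row<ζ₁ {T} ((shape , _) , _) {j} {r} e =
  <-≤-trans (proj₂ (entry⇒inShape (toSkew T) j r e)) (subst (outer (toSkew T) j ≤_) (outer₀ T) (outer-antitone shape z≤n))
  where
  outer₀ : ∀ T → outer (toSkew T) 0 ≡ ζ₁ T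
  outer₀ []      = refl
  outer₀ (_ ∷ _) = refl

ζ₁-positive : ∀ {T} → IsTableau T → 0 < length T → 0 < ζ₁ T
ζ₁-positive {_ ∷ _} (_ , nonempty ∷ _) _ = nonempty

tableau-chain-length≤ζ₁ : ∀ {T} → IsTableau T → ∀ {n j r x} → Chain (toSkew T) n j r x → n ≤ ζ₁ T
tableau-chain-length≤ζ₁ tab ch = ≤-trans (chain-length≤ ch) (tableau-row<ζ₁ tab (chain-end ch))

left-of-full-chain-end : ∀ {S T} → IsSkewTableau S → Rectifies S T → IsTableau T →
                         ∀ {k R y} → Chain S (ζ₁ T) k R y →
                         ∀ {j r v} → entry S j r ≡ just v → j ≤ k → v ≤ y
left-of-full-chain-end tab rect tabT {R = R} {y} ch {r = r} {v} e j≤k with r ≤? R | v ≤? y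
... | yes r≤R | _     = entry-monotone tab e (chain-end ch) j≤k r≤R
... | no  _   | yes v≤y = v≤y
... | no  r≰R | no  v≰y with rectification-preserves-chain tab rect (snoc ch e (≰⇒> r≰R) (≰⇒> v≰y))
...   | _ , _ , _ , ch' = ⊥-elim (1+n≰n (tableau-chain-length≤ζ₁ tabT ch'))

columnAt-∷ʳ : ∀ S col → columnAt (S ∷ʳ col) (length S) ≡ col
columnAt-∷ʳ []      col = refl
columnAt-∷ʳ (_ ∷ S) col = columnAt-∷ʳ S col

entry-∷ʳ-column≤ : ∀ S col {j r x} → entry (S ∷ʳ col) j r ≡ just x → j ≤ length S
entry-∷ʳ-column≤ []      col {zero}  e = z≤n
entry-∷ʳ-column≤ (_ ∷ S) col {zero}  e = z≤n
entry-∷ʳ-column≤ (_ ∷ S) col {suc j} e = s≤s (entry-∷ʳ-column≤ S col e)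

last-column-bottom : ∀ S o c → 0 < length c →
                     entry (S ∷ʳ (o , c)) (length S) (o + pred (length c)) ≡ just (bottom c)
last-column-bottom S o c nonempty = begin
  entry (S ∷ʳ (o , c)) (length S) R                  ≡⟨ entry≡columnEntry (S ∷ʳ (o , c)) (length S) R ⟩
  columnEntry (columnAt (S ∷ʳ (o , c)) (length S)) R ≡⟨ cong (λ col → columnEntry col R) (columnAt-∷ʳ S (o , c)) ⟩
  columnEntry (o , c) R                              ≡⟨ columnEntry-shifted o c R (m≤m+n o _) ⟩
  nth c (R ∸ o)                                      ≡⟨ cong (nth c) (m+n∸m≡n o _) ⟩
  nth c (pred (length c))                            ≡⟨ nth-bottom c nonempty ⟩
  just (bottom c)                                    ∎
  where
  open ≡-Reasoning
  R = o + pred (length c)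

last-column-chain : ∀ {S o c} → IsSkewTableau (S ∷ʳ (o , c)) → 0 < length c →
                    Chain (S ∷ʳ (o , c)) (length c) (length S) (o + pred (length c)) (bottom c)
last-column-chain {S} {o} {c@(_ ∷ _)} tab nonempty =
  subst (λ n → Chain (S ∷ʳ (o , c)) (suc n) (length S) R (bottom c)) rows-above-bottom
    (column-chain tab (last-column-bottom S o c nonempty))
  where
  R = o + pred (length c)
  rows-above-bottom : R ∸ inner (S ∷ʳ (o , c)) (length S) ≡ pred (length c)
  rows-above-bottom = trans (cong (R ∸_) (cong proj₁ (columnAt-∷ʳ S (o , c)))) (m+n∸m≡n o _)

corollary4p3 : (T : List Column) → IsTableau T → 0 < length T →
    (c : Column) → IsR1 T c → bottom c ≡ S1B T
corollary4p3 T tabT T≢[] c (S₀ , o , tab , rect , _ , |c|≡ζ₁) = ≤-antisym bottom≤S1B S1B≤bottom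
  where
  c≢[] : 0 < length c
  c≢[] = subst (0 <_) (sym |c|≡ζ₁) (ζ₁-positive tabT T≢[])
  bottom≤S1B : bottom c ≤ S1B T
  bottom≤S1B with rectification-keeps-occurrence {T = T} tab rect (last-column-bottom S₀ o c c≢[])
  ... | _ , _ , e = tableau-entry≤S1B tabT e
  full-column : Chain (S₀ ∷ʳ (o , c)) (ζ₁ T) (length S₀) (o + pred (length c)) (bottom c)
  full-column = subst (λ n → Chain (S₀ ∷ʳ (o , c)) n _ _ _) |c|≡ζ₁ (last-column-chain tab c≢[])
  S1B≤bottom : S1B T ≤ bottom c
  S1B≤bottom with S1B-occurs tabT T≢[]
  ... | _ , _ , e with rectification-occurrence-origin {T = T} rect e
  ...   | _ , _ , e' = left-of-full-chain-end {T = T} tab rect tabT full-column e' (entry-∷ʳ-column≤ S₀ (o , c) e')
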